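{- For every $n\ge1$ and every $n$-vertex line metric $L_n$, every 1-spanner of $L_n$ with hop-diameter 2 has the complete graph $K_{\lfloor\log n\rfloor+1}$ as a minor.
   Context: A line metric is a finite set of points on the real line with the distance $|x-y|$. A 1-spanner with hop-diameter $k$ of a metric $(X,\delta)$ is a graph $H$ on $X$, edges $(x,y)$ weighted by $\delta(x,y)$, such that for all $u,v\in X$ there is a $u$–$v$ path in $H$ with at most $k$ edges and length exactly $\delta(u,v)$. $\log$ is base 2.
   Formalization: The points of the line metric $L_n$ are rationals instead of reals. -}

module Defs where

open import Data.Nat using (ℕ; zero; suc; _≤_)
open import Data.Fin using (Fin)
open import Data.Rational using (ℚ; _-_; _+_; ∣_∣; 0ℚ)
open import Data.Product using (_×_; Σ; ∃; ∃₂)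
open import Relation.Binary.PropositionalEquality using (_≡_; _≢_)
open import Relation.Nullary using (¬_)
import Data.Empty
open import Function.Definitions using (Injective)

-- An n-point line metric: n distinct points on the line, given by an
-- injective map Fin n → ℚ; the distance is δ(i,j) = ∣ p i - p j ∣.
record LineMetric (n : ℕ) : Set where
  field
    pt    : Fin n → ℚ
    inj   : Injective _≡_ _≡_ pt

record Graph (n : ℕ) : Set₁ where
  field
    Adj   : Fin n → Fin n → Set
    sym   : ∀ {x y} → Adj x y → Adj y x
    irrefl : ∀ {x} → ¬ Adj x x

data Walk {n : ℕ} (R : Fin n → Fin n → Set) : Fin n → Fin n → Set where
  []  : ∀ {x} → Walk R x x
  _∷_ : ∀ {x y z} → R x y → Walk R y z → Walk R x z

hops : ∀ {n} {R : Fin n → Fin n → Set} {x y} → Walk R x y → ℕ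
hops []      = zero
hops (_ ∷ w) = suc (hops w)

len : ∀ {n} (L : LineMetric n) {R : Fin n → Fin n → Set} {x y} → Walk R x y → ℚ
len L []                  = 0ℚ
len L (_∷_ {x} {y} _ w)   = ∣ LineMetric.pt L x - LineMetric.pt L y ∣ + len L w

IsSpanner1Hop : ∀ {n} → LineMetric n → Graph n → ℕ → Set
IsSpanner1Hop L H k =
  ∀ u v → Σ (Walk (Graph.Adj H) u v) λ w →
    (hops w ≤ k) × (len L w ≡ ∣ LineMetric.pt L u - LineMetric.pt L v ∣)

record KMinorModel {n : ℕ} (H : Graph n) (t : ℕ) : Set₁ where
  open Graph H
  field
    branch    : Fin t → Fin n → Set
    nonempty  : ∀ i → ∃ λ x → branch i x
    disjoint  : ∀ i j x → i ≢ j → branch i x → branch j x → Data.Empty.⊥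
    connected : ∀ i x y → branch i x → branch i y →
                Walk (λ a b → Adj a b × branch i a × branch i b) x y
    joined    : ∀ i j → i ≢ j → ∃₂ λ x y → branch i x × branch j y × Adj x y

HasCompleteMinor : ∀ {n} → Graph n → ℕ → Set₁
HasCompleteMinor H t = KMinorModel H t

{-# OPTIONS --safe #-}

-- Cut the points at their median c. For l left of c and r right of it, the exact l–r path of
-- at most two hops runs monotonically along the line, so it crosses the cut in one edge: either
-- r has a neighbour left of c or l has one right of c. A finite search turns this into a
-- dichotomy: one half is adjacent to every point of the other half. Sets of points that are
-- intervals are connected in the spanner, again by monotone paths, so that half becomes a branch
-- set, and the recursion on the other half, which still has at least 2^(k-1) of the 2^k points,
-- provides the remaining branch sets, each of them joined to it.

module Submission where

open import Defs
open import Data.Nat using (ℕ; _≥_; suc)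
open import Data.Nat.Logarithm using (⌊log₂_⌋)

open import Level using (0ℓ)
open import Function using (_∘_; id; const)
open import Data.Empty using (⊥; ⊥-elim)
open import Data.Unit using (tt)
open import Data.Product using (Σ; ∃; ∃₂; _×_; _,_; proj₁)
open import Data.Sum using (_⊎_; inj₁; inj₂; [_,_]′)
import Data.Sum as Sum
open import Data.Nat.Logarithm.Core using (⌊log2⌋)
open import Induction.WellFounded using (Acc; acc)
open import Data.Fin using (Fin; zero; suc)
open import Data.Fin.Properties using (∀-cons)
open import Data.List using (List; []; _∷_; _++_; length; allFin)
open import Data.List.Properties using (length-++; length-tabulate)
open import Data.List.Relation.Unary.All as All using (All; []; _∷_)
import Data.List.Relation.Unary.All.Properties as All
open import Data.List.Relation.Unary.AllPairs as AllPairs using (AllPairs; []; _∷_)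
import Data.List.Relation.Unary.Linked.Properties as Linked
import Data.List.Relation.Unary.Unique.Propositional.Properties as Unique
open import Data.List.Relation.Binary.Permutation.Propositional using (↭-sym; ↭⇒↭ₛ)
open import Data.List.Relation.Binary.Permutation.Propositional.Properties using (↭-length)
import Data.List.Relation.Binary.Permutation.Setoid.Properties as Permutationₛ
import Data.List.Sort as Sort
import Data.Rational as ℚ
import Data.Rational.Properties as ℚ
open import Relation.Binary.Construct.On using (decTotalOrder)
open import Relation.Binary.PropositionalEquality
open import Relation.Nullary using (¬_; yes; no)
open import Relation.Unary using (Pred; Decidable; Satisfiable; Empty; _⊆_; _∩_; _∪_; ∅; U)
open import Relation.Unary.Properties using (_∩?_; U?)

module _ where
  open import Data.Rational using (ℚ; 0ℚ; _≤_; _<_; _+_; _-_; -_; ∣_∣)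
  open import Data.Rational.Properties
  open import Algebra.Properties.AbelianGroup +-0-abelianGroup
    using (⁻¹-anti-homo‿-; //-rightDividesˡ)
  open import Data.Rational.Solver using (module +-*-Solver)
  open +-*-Solver using (solve; _:=_; _:+_; _:-_)

  Between : ℚ → ℚ → ℚ → Set
  Between a b c = (a ≤ b × b ≤ c) ⊎ (c ≤ b × b ≤ a)

  p≤q⇒0≤q-p : ∀ {p q} → p ≤ q → 0ℚ ≤ q - p
  p≤q⇒0≤q-p {p} {q} p≤q = subst (_≤ q - p) (+-inverseʳ p) (+-monoˡ-≤ (- p) p≤q)

  0≤q-p⇒p≤q : ∀ {p q} → 0ℚ ≤ q - p → p ≤ q
  0≤q-p⇒p≤q {p} {q} 0≤q-p =
    subst₂ _≤_ (+-identityˡ p) (//-rightDividesˡ p q) (+-monoˡ-≤ p 0≤q-p)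

  p≤∣p∣ : ∀ p → p ≤ ∣ p ∣
  p≤∣p∣ p with ≤-total 0ℚ p
  ... | inj₁ 0≤p = ≤-reflexive (sym (0≤p⇒∣p∣≡p 0≤p))
  ... | inj₂ p≤0 = ≤-trans p≤0 (0≤∣p∣ p)

  ∣p-q∣≡∣q-p∣ : ∀ p q → ∣ p - q ∣ ≡ ∣ q - p ∣
  ∣p-q∣≡∣q-p∣ p q = trans (sym (∣-p∣≡∣p∣ (p - q))) (cong ∣_∣ (⁻¹-anti-homo‿- p q))

  ∣p∣+∣q∣≡p+q⇒0≤p : ∀ p q → ∣ p ∣ + ∣ q ∣ ≡ p + q → 0ℚ ≤ p
  ∣p∣+∣q∣≡p+q⇒0≤p p q eq = ∣p∣≡p⇒0≤p (≤-antisym (≮⇒≥ p≮∣p∣) (p≤∣p∣ p))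
    where
    p≮∣p∣ : ¬ p < ∣ p ∣
    p≮∣p∣ p<∣p∣ = <-irrefl (sym eq) (+-mono-<-≤ p<∣p∣ (p≤∣p∣ q))

  triangle-equality⇒between-≤ : ∀ {a b c} → a ≤ c →
    ∣ a - b ∣ + ∣ b - c ∣ ≡ ∣ a - c ∣ → a ≤ b × b ≤ c
  triangle-equality⇒between-≤ {a} {b} {c} a≤c eq =
    0≤q-p⇒p≤q (∣p∣+∣q∣≡p+q⇒0≤p (b - a) (c - b) eq′) ,
    0≤q-p⇒p≤q (∣p∣+∣q∣≡p+q⇒0≤p (c - b) (b - a)
      (trans (+-comm ∣ c - b ∣ ∣ b - a ∣) (trans eq′ (+-comm (b - a) (c - b)))))
    where
    open ≡-Reasoning
    eq′ : ∣ b - a ∣ + ∣ c - b ∣ ≡ (b - a) + (c - b)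
    eq′ = begin
      ∣ b - a ∣ + ∣ c - b ∣  ≡⟨ cong₂ _+_ (∣p-q∣≡∣q-p∣ b a) (∣p-q∣≡∣q-p∣ c b) ⟩
      ∣ a - b ∣ + ∣ b - c ∣  ≡⟨ eq ⟩
      ∣ a - c ∣              ≡⟨ ∣p-q∣≡∣q-p∣ a c ⟩
      ∣ c - a ∣              ≡⟨ 0≤p⇒∣p∣≡p (p≤q⇒0≤q-p a≤c) ⟩
      c - a                  ≡⟨ solve 3 (λ a b c → c :- a := (b :- a) :+ (c :- b)) refl a b c ⟩
      (b - a) + (c - b)      ∎

  triangle-equality⇒between : ∀ {a b c} → ∣ a - b ∣ + ∣ b - c ∣ ≡ ∣ a - c ∣ → Between a b c
  triangle-equality⇒between {a} {b} {c} eq with ≤-total a c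
  ... | inj₁ a≤c = inj₁ (triangle-equality⇒between-≤ a≤c eq)
  ... | inj₂ c≤a = inj₂ (triangle-equality⇒between-≤ c≤a (begin
    ∣ c - b ∣ + ∣ b - a ∣  ≡⟨ +-comm ∣ c - b ∣ ∣ b - a ∣ ⟩
    ∣ b - a ∣ + ∣ c - b ∣  ≡⟨ cong₂ _+_ (∣p-q∣≡∣q-p∣ b a) (∣p-q∣≡∣q-p∣ c b) ⟩
    ∣ a - b ∣ + ∣ b - c ∣  ≡⟨ eq ⟩
    ∣ a - c ∣              ≡⟨ ∣p-q∣≡∣q-p∣ a c ⟩
    ∣ c - a ∣              ∎))
    where open ≡-Reasoning

open import Data.Nat using (zero; _+_; _*_; _^_; _≤_; _<_; z≤n; s≤s; ⌊_/2⌋; ⌈_/2⌉)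
open import Data.Nat.Properties
  using ( ≤-refl; ≤-reflexive; <-≤-trans; n<1+n; n≮0; m^n>0; +-identityʳ; *-suc
        ; +-monoʳ-≤; *-monoʳ-≤; +-cancelˡ-≤; ^-monoʳ-<; ⌊n/2⌋≤⌈n/2⌉; ⌊n/2⌋+⌈n/2⌉≡n
        ; module ≤-Reasoning)

∀[P⊎C]⇒∀P⊎C : ∀ {m} {P : Fin m → Set} {C : Set} → (∀ i → P i ⊎ C) → (∀ i → P i) ⊎ C
∀[P⊎C]⇒∀P⊎C {zero}  f = inj₁ λ ()
∀[P⊎C]⇒∀P⊎C {suc m} f with f zero | ∀[P⊎C]⇒∀P⊎C (f ∘ suc)
... | inj₂ c  | _       = inj₂ c
... | inj₁ _  | inj₂ c  = inj₂ c
... | inj₁ p₀ | inj₁ ps = inj₁ (∀-cons p₀ ps)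

∀∀[P⊎Q]⇒∀P⊎∀Q : ∀ {m} {P Q : Fin m → Set} → (∀ i j → P j ⊎ Q i) → (∀ j → P j) ⊎ (∀ i → Q i)
∀∀[P⊎Q]⇒∀P⊎∀Q f = Sum.swap (∀[P⊎C]⇒∀P⊎C (λ i → Sum.swap (∀[P⊎C]⇒∀P⊎C (f i))))

split-at : ∀ {A : Set} m (xs : List A) → m < length xs →
           ∃₂ λ ys c → ∃ λ zs → xs ≡ ys ++ c ∷ zs × length ys ≡ m
split-at zero    (x ∷ xs) _         = [] , x , xs , refl , refl
split-at (suc m) (x ∷ xs) (s≤s m<) with split-at m xs m<
... | ys , c , zs , refl , refl = x ∷ ys , c , zs , refl , refl

AllPairs-++⁻ : ∀ {A : Set} {R : A → A → Set} xs {ys} → AllPairs R (xs ++ ys) →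
               AllPairs R xs × AllPairs R ys × All (λ x → All (R x) ys) xs
AllPairs-++⁻ []       rs         = [] , rs , []
AllPairs-++⁻ (x ∷ xs) (r ∷ rs) with AllPairs-++⁻ xs rs
... | rxs , rys , rxys = All.++⁻ˡ xs r ∷ rxs , rys , All.++⁻ʳ xs r ∷ rxys

2^⌊log2⌋n≤n : ∀ n (rec : Acc _<_ n) → 1 ≤ n → 2 ^ ⌊log2⌋ n rec ≤ n
2^⌊log2⌋n≤n 1             _        _ = ≤-refl
2^⌊log2⌋n≤n (suc (suc m)) (acc rs) _ = begin
  2 * 2 ^ ⌊log2⌋ (suc h) _  ≤⟨ *-monoʳ-≤ 2 (2^⌊log2⌋n≤n (suc h) _ (s≤s z≤n)) ⟩
  2 * suc h                ≡⟨ *-suc 2 h ⟩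
  2 + (h + (h + 0))        ≡⟨ cong (λ k → 2 + (h + k)) (+-identityʳ h) ⟩
  2 + (h + h)              ≤⟨ +-monoʳ-≤ 2 (+-monoʳ-≤ h (⌊n/2⌋≤⌈n/2⌉ m)) ⟩
  2 + (h + ⌈ m /2⌉)        ≡⟨ cong (2 +_) (⌊n/2⌋+⌈n/2⌉≡n m) ⟩
  2 + m                    ∎
  where
  open ≤-Reasoning
  h : ℕ
  h = ⌊ m /2⌋

module _ {n : ℕ} (H : Graph n) where
  open Graph H using (Adj) renaming (sym to Adj-sym)

  Connected : Pred (Fin n) 0ℓ → Set
  Connected Z = ∀ x y → Z x → Z y → Walk (λ a b → Adj a b × Z a × Z b) x y

  Neighbourhood : Pred (Fin n) 0ℓ → Pred (Fin n) 0ℓ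
  Neighbourhood Z y = ∃ λ x → Z x × Adj y x

  ModelWithin : ℕ → Pred (Fin n) 0ℓ → Set₁
  ModelWithin t S = Σ (KMinorModel H t) λ M → ∀ i → KMinorModel.branch M i ⊆ S

  emptyModel : ModelWithin 0 ∅
  emptyModel = record { branch = λ () ; nonempty = λ () ; disjoint = λ ()
                      ; connected = λ () ; joined = λ () }
             , λ ()

  ModelWithin-mono : ∀ {t S T} → S ⊆ T → ModelWithin t S → ModelWithin t T
  ModelWithin-mono S⊆T (M , M⊆S) = M , λ i → S⊆T ∘ M⊆S i

  addBranch : ∀ {t Z S} → Satisfiable Z → Connected Z → Empty (Z ∩ S) →
              S ⊆ Neighbourhood Z → ModelWithin t S → ModelWithin (suc t) (Z ∪ S)
  addBranch {t} {Z} {S} Z≢∅ Z-connected Z∩S≡∅ S⊆NZ (M , M⊆S) = M′ , within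
    where
    open KMinorModel M

    branch′ : Fin (suc t) → Pred (Fin n) 0ℓ
    branch′ zero    = Z
    branch′ (suc i) = branch i

    within : ∀ i → branch′ i ⊆ Z ∪ S
    within zero    = inj₁
    within (suc i) = inj₂ ∘ M⊆S i

    nonempty′ : ∀ i → Satisfiable (branch′ i)
    nonempty′ zero    = Z≢∅
    nonempty′ (suc i) = nonempty i

    disjoint′ : ∀ i j x → i ≢ j → branch′ i x → branch′ j x → ⊥
    disjoint′ zero    zero    x i≢j _  _  = i≢j refl
    disjoint′ zero    (suc j) x _   zx bx = Z∩S≡∅ x (zx , M⊆S j bx)
    disjoint′ (suc i) zero    x _   bx zx = Z∩S≡∅ x (zx , M⊆S i bx)
    disjoint′ (suc i) (suc j) x i≢j bi bj = disjoint i j x (i≢j ∘ cong suc) bi bj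

    connected′ : ∀ i → Connected (branch′ i)
    connected′ zero    = Z-connected
    connected′ (suc i) = connected i

    neighbourOf : ∀ i → ∃₂ λ x y → Z x × branch i y × Adj x y
    neighbourOf i with nonempty i
    ... | y , by with S⊆NZ (M⊆S i by)
    ...   | x , zx , y~x = x , y , zx , by , Adj-sym y~x

    joined′ : ∀ i j → i ≢ j → ∃₂ λ x y → branch′ i x × branch′ j y × Adj x y
    joined′ zero    zero    i≢j = ⊥-elim (i≢j refl)
    joined′ zero    (suc j) _   = neighbourOf j
    joined′ (suc i) zero    _   with neighbourOf i
    ... | x , y , zx , by , x~y = y , x , by , zx , Adj-sym x~y
    joined′ (suc i) (suc j) i≢j = joined i j (i≢j ∘ cong suc)

    M′ : KMinorModel H (suc t)
    M′ = record { branch = branch′ ; nonempty = nonempty′ ; disjoint = disjoint′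
                ; connected = connected′ ; joined = joined′ }

module _ {n : ℕ} (L : LineMetric n) where
  open LineMetric L

  Convex : Pred (Fin n) 0ℓ → Set
  Convex I = ∀ {x y z} → I x → I y → Between (pt x) (pt z) (pt y) → I z

  Left Right : Pred (Fin n) 0ℓ → Fin n → Pred (Fin n) 0ℓ
  Left  I c = I ∩ λ z → pt z ℚ.< pt c
  Right I c = I ∩ λ z → pt c ℚ.≤ pt z

  Left-convex : ∀ {I} c → Convex I → Convex (Left I c)
  Left-convex c I-convex (Ix , x<c) (Iy , y<c) x-z-y@(inj₁ (_ , z≤y)) =
    I-convex Ix Iy x-z-y , ℚ.≤-<-trans z≤y y<c
  Left-convex c I-convex (Ix , x<c) (Iy , y<c) x-z-y@(inj₂ (_ , z≤x)) =
    I-convex Ix Iy x-z-y , ℚ.≤-<-trans z≤x x<c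

  Right-convex : ∀ {I} c → Convex I → Convex (Right I c)
  Right-convex c I-convex (Ix , c≤x) (Iy , c≤y) x-z-y@(inj₁ (x≤z , _)) =
    I-convex Ix Iy x-z-y , ℚ.≤-trans c≤x x≤z
  Right-convex c I-convex (Ix , c≤x) (Iy , c≤y) x-z-y@(inj₂ (y≤z , _)) =
    I-convex Ix Iy x-z-y , ℚ.≤-trans c≤y y≤z

  Left? : ∀ {I} → Decidable I → ∀ c → Decidable (Left I c)
  Left? I? c = I? ∩? λ z → pt z ℚ.<? pt c

  Right? : ∀ {I} → Decidable I → ∀ c → Decidable (Right I c)
  Right? I? c = I? ∩? λ z → pt c ℚ.≤? pt z

  Left-Right-disjoint : ∀ {I c} → Empty (Left I c ∩ Right I c)
  Left-Right-disjoint x ((_ , x<c) , (_ , c≤x)) = ℚ.<-irrefl refl (ℚ.<-≤-trans x<c c≤x)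

  Increasing : List (Fin n) → Set
  Increasing = AllPairs (λ a b → pt a ℚ.< pt b)

  record Chain (I : Pred (Fin n) 0ℓ) (k : ℕ) : Set where
    field
      points     : List (Fin n)
      increasing : Increasing points
      inside     : All I points
      large      : 2 ^ k ≤ length points

  Chain⇒Satisfiable : ∀ {I k} → Chain I k → Satisfiable I
  Chain⇒Satisfiable record { points = x ∷ _ ; inside = Ix ∷ _ } = x , Ix
  Chain⇒Satisfiable {k = k} record { points = [] ; large = large } =
    ⊥-elim (n≮0 (<-≤-trans (m^n>0 2 k) large))

  halve : ∀ {I k} → Chain I (suc k) → ∃ λ c → Chain (Left I c) k × Chain (Right I c) k
  halve {I} {k} record { points = xs ; increasing = xs↑ ; inside = xs⊆I ; large = |xs|≥2^[1+k] }
    with split-at (2 ^ k) xs (<-≤-trans (^-monoʳ-< 2 ≤-refl (n<1+n k)) |xs|≥2^[1+k])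
  ... | ys , c , zs , refl , |ys|≡2^k with AllPairs-++⁻ ys xs↑
  ...   | ys↑ , czs↑ , ys<czs = c , left , right
    where
    |czs|≥2^k : 2 ^ k ≤ length (c ∷ zs)
    |czs|≥2^k = +-cancelˡ-≤ (2 ^ k) _ _ (begin
      2 ^ k + 2 ^ k                ≡⟨ cong (2 ^ k +_) (sym (+-identityʳ (2 ^ k))) ⟩
      2 ^ suc k                    ≤⟨ |xs|≥2^[1+k] ⟩
      length (ys ++ c ∷ zs)        ≡⟨ length-++ ys ⟩
      length ys + length (c ∷ zs)  ≡⟨ cong (_+ length (c ∷ zs)) |ys|≡2^k ⟩
      2 ^ k + length (c ∷ zs)      ∎)
      where open ≤-Reasoning

    left : Chain (Left I c) k
    left = record
      { points     = ys
      ; increasing = ys↑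
      ; inside     = All.zip (All.++⁻ˡ ys xs⊆I , All.map All.head ys<czs)
      ; large      = ≤-reflexive (sym |ys|≡2^k)
      }

    right : Chain (Right I c) k
    right = record
      { points     = c ∷ zs
      ; increasing = czs↑
      ; inside     = All.zip (All.++⁻ʳ ys xs⊆I , ℚ.≤-refl ∷ All.map ℚ.<⇒≤ (AllPairs.head czs↑))
      ; large      = |czs|≥2^k
      }

  allPoints : ∀ k → 2 ^ k ≤ n → Chain U k
  allPoints k 2^k≤n = record
    { points     = xs
    ; increasing = AllPairs.zipWith (λ (x≤y , x≢y) → strict x≤y x≢y) (sorted , unique)
    ; inside     = All.universal _ xs
    ; large      = subst (2 ^ k ≤_) (sym |xs|≡n) 2^k≤n
    }
    where
    open Sort (decTotalOrder ℚ.≤-decTotalOrder pt) using (sort; sort-↭; sort-↗)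

    xs : List (Fin n)
    xs = sort (allFin n)

    sorted : AllPairs (λ x y → pt x ℚ.≤ pt y) xs
    sorted = Linked.Linked⇒AllPairs ℚ.≤-trans (sort-↗ (allFin n))

    unique : AllPairs _≢_ xs
    unique = Permutationₛ.Unique-resp-↭ (setoid (Fin n)) (↭⇒↭ₛ (↭-sym (sort-↭ (allFin n))))
                                        (Unique.allFin⁺ n)

    strict : ∀ {x y} → pt x ℚ.≤ pt y → x ≢ y → pt x ℚ.< pt y
    strict {x} {y} x≤y x≢y with pt y ℚ.≤? pt x
    ... | yes y≤x = ⊥-elim (x≢y (inj (ℚ.≤-antisym x≤y y≤x)))
    ... | no  y≰x = ℚ.≰⇒> y≰x

    |xs|≡n : length xs ≡ n
    |xs|≡n = trans (↭-length (sort-↭ (allFin n))) (length-tabulate id)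

module _ {n : ℕ} (L : LineMetric n) (H : Graph n) (spanner : IsSpanner1Hop L H 2) where
  open LineMetric L
  open Graph H using (Adj) renaming (sym to Adj-sym)

  data MonotonePath : Fin n → Fin n → Set where
    stay : ∀ {u} → MonotonePath u u
    edge : ∀ {u v} → Adj u v → MonotonePath u v
    via  : ∀ {u v} w → Adj u w → Adj w v → Between (pt u) (pt w) (pt v) → MonotonePath u v

  monotonePath : ∀ u v → MonotonePath u v
  monotonePath u v with spanner u v
  ... | [] , _ , _                                         = stay
  ... | u~v ∷ [] , _ , _                                   = edge u~v
  ... | _∷_ {y = w} u~w (w~v ∷ []) , _ , length≡distance =
    via w u~w w~v (triangle-equality⇒between
      (trans (cong (ℚ.∣ pt u ℚ.- pt w ∣ ℚ.+_) (sym (ℚ.+-identityʳ _))) length≡distance))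
  ... | _ ∷ _ ∷ _ ∷ _ , s≤s (s≤s ()) , _

  convex⇒connected : ∀ {I} → Convex L I → Connected H I
  convex⇒connected I-convex x y Ix Iy with monotonePath x y
  ... | stay            = []
  ... | edge x~y        = (x~y , Ix , Iy) ∷ []
  ... | via w x~w w~y x-w-y with I-convex Ix Iy x-w-y
  ...   | Iw = (x~w , Ix , Iw) ∷ (w~y , Iw , Iy) ∷ []

  crossing : ∀ {I c l r} → Convex L I → Left L I c l → Right L I c r →
             Neighbourhood H (Left L I c) r ⊎ Neighbourhood H (Right L I c) l
  crossing {c = c} {l} {r} I-convex l∈Left@(Il , l<c) (Ir , c≤r) with monotonePath l r
  ... | stay     = ⊥-elim (ℚ.<-irrefl refl (ℚ.<-≤-trans l<c c≤r))
  ... | edge l~r = inj₁ (l , l∈Left , Adj-sym l~r)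
  ... | via w l~w w~r l-w-r with I-convex Il Ir l-w-r | pt w ℚ.<? pt c
  ...   | Iw | yes w<c = inj₁ (w , (Iw , w<c) , Adj-sym w~r)
  ...   | Iw | no  w≮c = inj₂ (w , (Iw , ℚ.≮⇒≥ w≮c) , l~w)

  cut-dichotomy : ∀ {I} → Convex L I → Decidable I → ∀ c →
                  (Right L I c ⊆ Neighbourhood H (Left L I c)) ⊎
                  (Left L I c ⊆ Neighbourhood H (Right L I c))
  cut-dichotomy {I} I-convex I? c =
    Sum.map (λ f {r} → f r) (λ g {l} → g l) (∀∀[P⊎Q]⇒∀P⊎∀Q pair)
    where
    pair : ∀ l r → (Right L I c r → Neighbourhood H (Left L I c) r) ⊎
                   (Left L I c l → Neighbourhood H (Right L I c) l)
    pair l r with Left? L I? c l | Right? L I? c r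
    ... | no  l∉Left | _           = inj₂ (⊥-elim ∘ l∉Left)
    ... | yes _      | no r∉Right  = inj₁ (⊥-elim ∘ r∉Right)
    ... | yes l∈Left | yes r∈Right =
      Sum.map const const (crossing I-convex l∈Left r∈Right)

  completeMinorWithin : ∀ {I} k → Convex L I → Decidable I → Chain L I k → ModelWithin H (suc k) I
  completeMinorWithin zero I-convex _ chain =
    ModelWithin-mono H [ id , (λ ()) ]′
      (addBranch H (Chain⇒Satisfiable L chain) (convex⇒connected I-convex)
                   (λ _ ()) (λ ()) (emptyModel H))
  completeMinorWithin {I} (suc k) I-convex I? chain with halve L chain
  ... | c , left , right = [ growLeft , growRight ]′ (cut-dichotomy I-convex I? c)
    where
    growLeft : Right L I c ⊆ Neighbourhood H (Left L I c) → ModelWithin H (suc (suc k)) I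
    growLeft Right⊆N[Left] = ModelWithin-mono H [ proj₁ , proj₁ ]′
      (addBranch H (Chain⇒Satisfiable L left) (convex⇒connected (Left-convex L c I-convex))
                   (Left-Right-disjoint L) Right⊆N[Left]
                   (completeMinorWithin k (Right-convex L c I-convex) (Right? L I? c) right))

    growRight : Left L I c ⊆ Neighbourhood H (Right L I c) → ModelWithin H (suc (suc k)) I
    growRight Left⊆N[Right] = ModelWithin-mono H [ proj₁ , proj₁ ]′
      (addBranch H (Chain⇒Satisfiable L right) (convex⇒connected (Right-convex L c I-convex))
                   (λ x (r , l) → Left-Right-disjoint L {I} {c} x (l , r)) Left⊆N[Right]
                   (completeMinorWithin k (Left-convex L c I-convex) (Left? L I? c) left))

lemma3p5 : (n : ℕ) → n ≥ 1 → (L : LineMetric n) → (H : Graph n) →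
           IsSpanner1Hop L H 2 → HasCompleteMinor H (suc ⌊log₂ n ⌋)
lemma3p5 n n≥1 L H spanner =
  proj₁ (completeMinorWithin L H spanner ⌊log₂ n ⌋ (λ _ _ _ → tt) U?
           (allPoints L ⌊log₂ n ⌋ (2^⌊log2⌋n≤n n _ n≥1)))
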